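{- Let $(S,\to,\preceq)$ be a self-simulating transition system, $\phi$ a predicate on $S$ compatible with it, $(I,\trianglelefteq)$ a restricted reachability invariant of it with $I$ finite, and $f$ a restricted topological numbering for $(S,\to,\preceq)$, $\phi$ and $(I,\trianglelefteq)$. Then for every $s_0\in S$ for which there exists $t_0\in I$ with $s_0 \trianglelefteq t_0$, there is no Büchi run from $s_0$ in $\to$.
   Context: A transition system $(S,\to)$ is a set with a relation $\to\subseteq S\times S$. A self-simulating transition system (SSTS) $(S,\to,\preceq)$ is a transition system with a quasi-order (reflexive, transitive) $\preceq$ on $S$ such that for all $s,s',t$: if $s\preceq s'$ and $s\to t$ then there is $t'$ with $s'\to t'$ and $t\preceq t'$. A predicate $\phi$ on $S$ is compatible with the SSTS if $\phi(s)$ and $s\preceq s'$ imply $\phi(s')$. A Büchi run from $s_0$ is an infinite run $s_0\to s_1\to s_2\to\cdots$ with $\phi(s_i)$ for infinitely many $i$. A restricted reachability invariant is a pair $(I,\trianglelefteq)$ with $I\subseteq S$ and $\trianglelefteq$ a binary relation on $S$ such that (1) for all $s\in I$ and $t$ with $s\to t$ there exists $t'\in I$ with $t\trianglelefteq t'$, and (2) $s\trianglelefteq t$ implies $s\preceq t$. A restricted topological numbering (for the SSTS, $\phi$, and $(I,\trianglelefteq)$) is an integer-valued function $f$ on $I$ such that for all $s,t'\in I$ and $t\in S$ with $s\to t$ and $t\trianglelefteq t'$: $f(s)\ge f(t')$, and if moreover $\phi(s)$ then $f(s) > f(t')$. -}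

module Defs where

open import Level using (Level; _⊔_)
open import Data.Nat as ℕ using (ℕ; _≥_)
open import Relation.Binary.PropositionalEquality using (_≡_)
open import Data.Integer using (ℤ) renaming (_≥_ to _≥ℤ_; _>_ to _>ℤ_)
open import Data.Product using (Σ; ∃; ∃-syntax; _×_; _,_)
open import Data.List using (List)
open import Data.List.Membership.Propositional using (_∈_)
open import Relation.Binary.Core using (Rel)
open import Relation.Binary.Definitions using (Reflexive; Transitive)

record SSTS {a ℓ₁ ℓ₂ : Level} (S : Set a) : Set (a ⊔ Level.suc (ℓ₁ ⊔ ℓ₂)) where
  field
    _⟶_ : Rel S ℓ₁
    _≼_ : Rel S ℓ₂
    ≼-refl  : Reflexive _≼_
    ≼-trans : Transitive _≼_
    simulate : ∀ {s s′ t} → s ≼ s′ → s ⟶ t → ∃[ t′ ] (s′ ⟶ t′ × t ≼ t′)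

module _ {a ℓ₁ ℓ₂ : Level} {S : Set a} (T : SSTS {a} {ℓ₁} {ℓ₂} S) where
  open SSTS T

  Compatible : ∀ {p} → (S → Set p) → Set (a ⊔ ℓ₂ ⊔ p)
  Compatible φ = ∀ {s s′} → φ s → s ≼ s′ → φ s′

  record RestrictedReachabilityInvariant {i ℓ₃ : Level} (I : S → Set i) (_⊴_ : Rel S ℓ₃)
         : Set (a ⊔ ℓ₁ ⊔ ℓ₂ ⊔ i ⊔ ℓ₃) where
    field
      closed : ∀ {s t} → I s → s ⟶ t → ∃[ t′ ] (I t′ × t ⊴ t′)
      ⊴⇒≼    : ∀ {s t} → s ⊴ t → s ≼ t

  RestrictedTopologicalNumbering : ∀ {p i ℓ₃} (φ : S → Set p) (I : S → Set i) (_⊴_ : Rel S ℓ₃)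
    → (Σ S I → ℤ) → Set (a ⊔ ℓ₁ ⊔ p ⊔ i ⊔ ℓ₃)
  RestrictedTopologicalNumbering φ I _⊴_ f =
    ∀ {s t t′} (Is : I s) (It′ : I t′) → s ⟶ t → t ⊴ t′ →
      (f (s , Is) ≥ℤ f (t′ , It′)) × (φ s → f (s , Is) >ℤ f (t′ , It′))

  BuchiRun : ∀ {p} (φ : S → Set p) → S → Set (a ⊔ ℓ₁ ⊔ p)
  BuchiRun φ s₀ = Σ (ℕ → S) λ r →
      (r 0 ≡ s₀) × (∀ n → r n ⟶ r (ℕ.suc n)) × (∀ n → ∃[ m ] (m ≥ n × φ (r m)))

Finite : ∀ {a i} {S : Set a} → (S → Set i) → Set (a ⊔ i)
Finite {S = S} I = ∃[ xs ] (∀ {s : S} → I s → s ∈ xs)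

-- Follow a Büchi run r from s₀ by a shadow run u inside I: u starts at t₀, each r n ≼ u n
-- (by simulation), and u n ⟶ v ⊴ u (n+1) for some v (by the invariant).  Along u the numbering
-- never increases, and it strictly decreases at each of the infinitely many positions where φ
-- holds on r, hence (by compatibility) on u.  As I is finite, some φ-state of u recurs, so the
-- numbering would strictly decrease from that state back to itself.
module Submission where

open import Defs
open import Level using (Level; _⊔_)
open import Data.Integer as ℤ using (ℤ)
import Data.Integer.Properties as ℤ
open import Data.Nat as ℕ using (ℕ; zero; suc; s≤s)
import Data.Nat.Properties as ℕ
open import Data.Fin using (toℕ)
open import Data.Fin.Properties using (pigeonhole)
open import Data.List using (List; length; lookup)
open import Data.List.Membership.Propositional using (_∈_)
open import Data.List.Relation.Unary.Any using (index)
open import Data.List.Relation.Unary.Any.Properties using (lookup-index)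
open import Data.Product using (Σ; Σ-syntax; ∃-syntax; _×_; _,_; proj₁; proj₂)
open import Data.Sum using (inj₁; inj₂)
open import Relation.Binary.Core using (Rel; _Preserves_⟶_)
open import Relation.Binary.PropositionalEquality using (_≡_; refl; sym; trans; cong; subst)
open import Relation.Nullary using (¬_)
open import Function using (_∘_)

open RestrictedReachabilityInvariant using (closed; ⊴⇒≼)

InfinitelyOften : ∀ {p} → (ℕ → Set p) → Set p
InfinitelyOften P = ∀ n → ∃[ m ] (m ℕ.≥ n × P m)

InfinitelyOften-map : ∀ {p q} {P : ℕ → Set p} {Q : ℕ → Set q} →
  (∀ {n} → P n → Q n) → InfinitelyOften P → InfinitelyOften Q
InfinitelyOften-map P⇒Q io n with m , m≥n , Pm ← io n = m , m≥n , P⇒Q Pm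

step-<⇒strictlyIncreasing : {m : ℕ → ℕ} → (∀ k → m k ℕ.< m (suc k)) → m Preserves ℕ._<_ ⟶ ℕ._<_
step-<⇒strictlyIncreasing step {a} {suc b} (s≤s a≤b) with ℕ.m≤n⇒m<n∨m≡n a≤b
... | inj₂ refl = step a
... | inj₁ a<b  = ℕ.<-trans (step-<⇒strictlyIncreasing step a<b) (step b)

InfinitelyOften⇒subsequence : ∀ {p} {P : ℕ → Set p} → InfinitelyOften P →
  Σ[ m ∈ (ℕ → ℕ) ] (m Preserves ℕ._<_ ⟶ ℕ._<_ × ∀ k → P (m k))
InfinitelyOften⇒subsequence {P = P} io =
  m , step-<⇒strictlyIncreasing (λ k → proj₁ (proj₂ (io (suc (m k))))) , Pm
  where
  m : ℕ → ℕ
  m zero    = proj₁ (io 0)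
  m (suc k) = proj₁ (io (suc (m k)))

  Pm : ∀ k → P (m k)
  Pm zero    = proj₂ (proj₂ (io 0))
  Pm (suc k) = proj₂ (proj₂ (io (suc (m k))))

pigeonhole-∈ : ∀ {a} {A : Set a} {xs : List A} (g : ℕ → A) → (∀ n → g n ∈ xs) →
  ∃[ i ] ∃[ j ] (i ℕ.< j × g i ≡ g j)
pigeonhole-∈ {xs = xs} g g∈xs
  with i , j , i<j , same-index ← pigeonhole (ℕ.n<1+n (length xs)) (λ k → index (g∈xs (toℕ k)))
  = toℕ i , toℕ j , i<j , trans (lookup-index (g∈xs (toℕ i)))
                          (trans (cong (lookup xs) same-index) (sym (lookup-index (g∈xs (toℕ j)))))

Finite⇒recurrence : ∀ {a i p} {S : Set a} {I : S → Set i} {P : ℕ → Set p} → Finite I →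
  (u : ℕ → Σ S I) → InfinitelyOften P → ∃[ i ] ∃[ j ] (i ℕ.< j × P i × proj₁ (u i) ≡ proj₁ (u j))
Finite⇒recurrence (xs , I⊆xs) u io
  with m , m-mono , Pm ← InfinitelyOften⇒subsequence io
  with i , j , i<j , same ← pigeonhole-∈ (λ k → proj₁ (u (m k))) (λ k → I⊆xs (proj₂ (u (m k))))
  = m i , m j , m-mono i<j , Pm i , same

module _ {a ℓ₁ ℓ₂ i ℓ₃ : Level} {S : Set a} (T : SSTS {a} {ℓ₁} {ℓ₂} S)
         {I : S → Set i} {_⊴_ : Rel S ℓ₃} where
  open SSTS T

  _⟶⊴_ : Rel S (a ⊔ ℓ₁ ⊔ ℓ₃)
  s ⟶⊴ t = ∃[ v ] (s ⟶ v × v ⊴ t)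

  shadow-step : RestrictedReachabilityInvariant T I _⊴_ →
    ∀ {s t} (x : Σ S I) → s ≼ proj₁ x → s ⟶ t →
    Σ[ y ∈ Σ S I ] (t ≼ proj₁ y × proj₁ x ⟶⊴ proj₁ y)
  shadow-step RI (s′ , Is′) s≼s′ s⟶t
    with t′ , s′⟶t′ , t≼t′ ← simulate s≼s′ s⟶t
    with t″ , It″ , t′⊴t″ ← closed RI Is′ s′⟶t′
    = (t″ , It″) , ≼-trans t≼t′ (⊴⇒≼ RI t′⊴t″) , t′ , s′⟶t′ , t′⊴t″

  shadow-run : RestrictedReachabilityInvariant T I _⊴_ →
    {r : ℕ → S} → (∀ n → r n ⟶ r (suc n)) → (x₀ : Σ S I) → r 0 ≼ proj₁ x₀ →
    Σ[ u ∈ (ℕ → Σ S I) ] ((∀ n → r n ≼ proj₁ (u n)) ×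
                          (∀ n → proj₁ (u n) ⟶⊴ proj₁ (u (suc n))))
  shadow-run RI {r} run x₀ r₀≼x₀ = proj₁ ∘ shadow , proj₂ ∘ shadow , λ n → proj₂ (proj₂ (next n))
    where
    shadow : ∀ n → Σ[ x ∈ Σ S I ] (r n ≼ proj₁ x)
    next : ∀ n → Σ[ y ∈ Σ S I ] (r (suc n) ≼ proj₁ y × proj₁ (proj₁ (shadow n)) ⟶⊴ proj₁ y)
    shadow zero    = x₀ , r₀≼x₀
    shadow (suc n) = proj₁ (next n) , proj₁ (proj₂ (next n))
    next n = shadow-step RI (proj₁ (shadow n)) (proj₂ (shadow n)) (run n)

  -- f reads the membership proof as well as the state, and a recurrence only identifies states,
  -- so the endpoint y may carry any proof that its state lies in I.
  numbering-descent : ∀ {p} {φ : S → Set p} {f : Σ S I → ℤ} →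
    RestrictedTopologicalNumbering T φ I _⊴_ f →
    (u : ℕ → Σ S I) → (∀ n → proj₁ (u n) ⟶⊴ proj₁ (u (suc n))) →
    ∀ {i j} → i ℕ.< j → φ (proj₁ (u i)) → (y : Σ S I) → proj₁ y ≡ proj₁ (u j) → f y ℤ.< f (u i)
  numbering-descent top u steps {i} {suc k} (s≤s i≤k) φuᵢ (t , It) refl
    with v , uₖ⟶v , v⊴t ← steps k
    with ℕ.m≤n⇒m<n∨m≡n i≤k
  ... | inj₂ refl = proj₂ (top (proj₂ (u i)) It uₖ⟶v v⊴t) φuᵢ
  ... | inj₁ i<k  = ℤ.≤-<-trans (proj₁ (top (proj₂ (u k)) It uₖ⟶v v⊴t))
                                (numbering-descent top u steps i<k φuᵢ (u k) refl)

theorem3 : ∀ {a ℓ₁ ℓ₂ p i ℓ₃ : Level} {S : Set a} (T : SSTS {a} {ℓ₁} {ℓ₂} S)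
    (φ : S → Set p) → Compatible T φ →
    (I : S → Set i) (_⊴_ : Rel S ℓ₃) → RestrictedReachabilityInvariant T I _⊴_ →
    Finite I →
    (f : Σ S I → ℤ) → RestrictedTopologicalNumbering T φ I _⊴_ f →
    ∀ (s₀ : S) → ∃[ t₀ ] (I t₀ × s₀ ⊴ t₀) → ¬ BuchiRun T φ s₀
theorem3 T φ compat I _⊴_ RI fin f top s₀ (t₀ , It₀ , s₀⊴t₀) (r , r₀≡s₀ , run , φ-io)
  with u , r≼u , steps ← shadow-run T RI run (t₀ , It₀)
                           (subst (λ s → SSTS._≼_ T s t₀) (sym r₀≡s₀) (⊴⇒≼ RI s₀⊴t₀))
  with i , j , i<j , φuᵢ , uᵢ≡uⱼ ← Finite⇒recurrence fin u
                                          (InfinitelyOften-map (λ {n} φrₙ → compat φrₙ (r≼u n)) φ-io)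
  = ℤ.<-irrefl refl (numbering-descent T top u steps i<j φuᵢ (u i) uᵢ≡uⱼ)
  where
  φ-on-u : InfinitelyOften (λ n → φ (proj₁ (u n)))
  φ-on-u = InfinitelyOften-map (λ {n} φrₙ → compat φrₙ (r≼u n)) φ-io
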